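{- For the dynamic queue problem, every deterministic online algorithm has competitive ratio at least $\phi=(1+\sqrt5)/2\approx 1.618$; this holds even for decremental queues and even when every item is active during at most $2$ steps.
   Context: Dynamic set problem: each item $x$ has a weight $w_x \ge 0$. Time proceeds in steps $t=1,2,\dots$. Before each step, the instance may insert new items into a dynamic set $\mathcal{S}$ and delete items currently in $\mathcal{S}$. An item is active if it has been inserted and not yet deleted. At each step an algorithm may collect at most one active item it has not collected before; pending items are active items not yet collected by the algorithm. The gain is the total weight of collected items. Online algorithms decide at each step knowing only the past insertions and deletions. A deterministic online algorithm is $R$-competitive if on every instance its gain is at least $\mathrm{OPT}/R$, where $\mathrm{OPT}$ is the maximum achievable gain; its competitive ratio is the infimum of such $R$. Dynamic queue: $\mathcal{S}$ is a linearly ordered list; items may be inserted at any position, but at any time only a prefix of the current list may be deleted. Decremental: all items are inserted before the first step, and afterwards only deletions occur. -}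

module Defs where

open import Data.Nat as ℕ using (ℕ; zero; suc; _⊔_)
open import Data.Bool using (Bool; true; false; if_then_else_; _∧_; not; _∨_)
open import Data.Fin using (Fin; zero; suc; _≟_)
open import Data.Maybe using (Maybe; just; nothing)
open import Data.Rational using (ℚ; 0ℚ; 1ℚ; _+_; _*_; _≤_; _<_)
open import Data.Product using (Σ; ∃; _×_)
open import Data.Sum using (_⊎_)
open import Relation.Nullary.Decidable using (⌊_⌋)

-- An instance has n items, listed in queue order (index 0 = front).
-- Item i has weight  w i : ℚ  and lifetime  a i : ℕ : all items are
-- inserted before step 1, item i is active exactly during the steps
-- t = 1, …, a i, and it is deleted just before step (a i + 1).
-- (Steps are numbered 1, 2, 3, ….)

activeᵇ : ∀ {n} → (Fin n → ℕ) → ℕ → Fin n → Bool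
activeᵇ a t i = (1 ℕ.≤ᵇ t) ∧ (t ℕ.≤ᵇ a i)

-- Validity of a decremental queue instance in the class of the theorem:
--  * weights are nonnegative;
--  * only a prefix of the queue can be deleted at any time, i.e. items
--    closer to the front are deleted no later than items behind them;
--  * every item is active during at most 2 steps.
record ValidInstance (n : ℕ) (w : Fin n → ℚ) (a : Fin n → ℕ) : Set where
  field
    weights-nonneg : ∀ i → 0ℚ ≤ w i
    prefix-deletion : ∀ (i j : Fin n) → Data.Fin._≤_ i j → a i ℕ.≤ a j
    active-≤2 : ∀ i → a i ℕ.≤ 2

Schedule : ℕ → Set
Schedule n = ℕ → Maybe (Fin n)

collected : ∀ {n} → (Fin n → ℕ) → Schedule n → ℕ → Fin n → Bool
collected a s zero i = false
collected a s (suc t) i with s (suc t)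
... | nothing = collected a s t i
... | just j  = collected a s t i
                ∨ (⌊ i ≟ j ⌋ ∧ activeᵇ a (suc t) j ∧ not (collected a s t j))

sumFin : ∀ {n} → (Fin n → ℚ) → ℚ
sumFin {zero} f = 0ℚ
sumFin {suc n} f = f zero + sumFin (λ i → f (suc i))

maxFin : ∀ {n} → (Fin n → ℕ) → ℕ
maxFin {zero} f = 0
maxFin {suc n} f = f zero ⊔ maxFin (λ i → f (suc i))

-- after step (max lifetime) no item is active any more
horizon : ∀ {n} → (Fin n → ℕ) → ℕ
horizon = maxFin

gain : ∀ {n} → (Fin n → ℚ) → (Fin n → ℕ) → Schedule n → ℚ
gain w a s = sumFin (λ i → if collected a s (horizon a) i then w i else 0ℚ)

-- The algorithm knows all items (in queue order, with their weights),
-- since all are inserted before step 1.  At step t it also knows the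
-- deletions that happened before steps 1, …, t, i.e. for each item i
-- whether it has been deleted (a i < t), and if so when:

observe : ∀ {n} → (Fin n → ℕ) → ℕ → Fin n → Maybe ℕ
observe a t i = if a i ℕ.<ᵇ t then just (a i) else nothing

record OnlineAlgorithm : Set where
  field
    choose : (n : ℕ) → (Fin n → ℚ) → (t : ℕ) → (Fin n → Maybe ℕ) → Maybe (Fin n)

runOnline : OnlineAlgorithm → ∀ n → (Fin n → ℚ) → (Fin n → ℕ) → Schedule n
runOnline A n w a t = OnlineAlgorithm.choose A n w t (observe a t)

algGain : OnlineAlgorithm → ∀ n → (Fin n → ℚ) → (Fin n → ℕ) → ℚ
algGain A n w a = gain w a (runOnline A n w a)

-- R < φ = (1+√5)/2 for rational R: either R ≤ 1, or R > 1 and R² < R + 1.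
BelowGolden : ℚ → Set
BelowGolden R = R ≤ 1ℚ ⊎ R * R < R + 1ℚ

-- The algorithm fails to be R-competitive on the class of decremental
-- queue instances with lifetimes ≤ 2: some instance of that class and
-- some (offline) schedule achieve strictly more than R times the gain
-- of the algorithm, i.e. gain(A) < OPT / R.
NotCompetitive : OnlineAlgorithm → ℚ → Set
NotCompetitive A R =
  Σ ℕ λ n → Σ (Fin n → ℚ) λ w → Σ (Fin n → ℕ) λ a →
    ValidInstance n w a × Σ (Schedule n) λ s → R * algGain A n w a < gain w a s

-- Two items, the front one of weight 1 and the one behind it of weight x, both
-- active at step 1.  Before step 2 the adversary decides: if the algorithm took
-- the back item, only the front item is deleted, so the optimum collects both
-- (1 + x) while the algorithm can gain nothing more (x); otherwise both items
-- are deleted and the optimum takes the back item (x) while the algorithm has at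
-- most 1.  Both instances look the same at step 1, so the algorithm cannot tell
-- them apart.  An x with R < x and R x < 1 + x exists exactly when R < φ.
module Submission where

open import Defs
open import Data.Bool using (Bool; true; false; _∧_; _∨_; not; if_then_else_)
open import Data.Fin using (Fin; zero; suc; _≟_)
import Data.Fin as Fin
open import Data.Maybe using (Maybe; just; nothing)
open import Data.Nat as ℕ using (ℕ; suc; z≤n; s≤s)
import Data.Nat.Properties as ℕ
open import Data.Product using (Σ; _×_; _,_)
open import Data.Rational using (ℚ; 0ℚ; 1ℚ; _+_; _*_; _-_; -_; _≤_; _<_; nonNegative; positive)
open import Data.Rational.Properties
  using (<⇒≤; ≰⇒>; <-trans; ≤-<-trans; _≤?_; _<?_; +-identityˡ; +-identityʳ; +-inverseʳ; +-monoˡ-<; +-monoʳ-<;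
         *-identityʳ; *-zeroʳ; *-comm; *-distribˡ-+; *-monoˡ-≤-nonNeg; *-monoʳ-<-pos; *-cancelˡ-<-nonNeg; module ≤-Reasoning)
open import Data.Rational.Solver using (module +-*-Solver)
open import Data.Sum using (inj₁; inj₂)
open import Relation.Nullary using (yes; no)
open import Relation.Nullary.Decidable using (⌊_⌋; toWitness)
open import Data.Unit using (tt)
open import Relation.Binary.PropositionalEquality

open +-*-Solver

collectStep : ∀ {n} → (Fin n → ℕ) → (Fin n → Bool) → ℕ → Maybe (Fin n) → Fin n → Bool
collectStep a c t nothing  i = c i
collectStep a c t (just j) i = c i ∨ (⌊ i ≟ j ⌋ ∧ activeᵇ a t j ∧ not (c j))

collected-suc : ∀ {n} (a : Fin n → ℕ) (s : Schedule n) t i →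
                collected a s (suc t) i ≡ collectStep a (collected a s t) (suc t) (s (suc t)) i
collected-suc a s t i with s (suc t)
... | nothing = refl
... | just j  = refl

collectStep-cong : ∀ {n} (a : Fin n → ℕ) {c c′ : Fin n → Bool} → c ≗ c′ →
                   ∀ t m i → collectStep a c t m i ≡ collectStep a c′ t m i
collectStep-cong a c≗c′ t nothing  i = c≗c′ i
collectStep-cong a c≗c′ t (just j) i
  rewrite c≗c′ i | c≗c′ j = refl

sumFin-cong : ∀ {n} {f g : Fin n → ℚ} → f ≗ g → sumFin f ≡ sumFin g
sumFin-cong {ℕ.zero} f≗g = refl
sumFin-cong {suc n}  f≗g = cong₂ _+_ (f≗g zero) (sumFin-cong (λ i → f≗g (suc i)))

weightOf : ∀ {n} → (Fin n → ℚ) → (Fin n → Bool) → ℚ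
weightOf w c = sumFin (λ i → if c i then w i else 0ℚ)

gain-cong : ∀ {n} (w : Fin n → ℚ) (a : Fin n → ℕ) (s : Schedule n) {c : Fin n → Bool} →
            collected a s (horizon a) ≗ c → gain w a s ≡ weightOf w c
gain-cong w a s coll = sumFin-cong (λ i → cong (λ b → if b then w i else 0ℚ) (coll i))

pattern front = zero
pattern back  = suc zero

weights : ℚ → Fin 2 → ℚ
weights x front = 1ℚ
weights x back  = x

bothExpire : Fin 2 → ℕ
bothExpire _ = 1

-- Written as a successor so that "not yet deleted at step 1" holds by computation.
backSurvives : Fin 2 → ℕ
backSurvives i = suc (Fin.toℕ i)

weights-nonneg : ∀ x → 0ℚ ≤ x → ∀ i → 0ℚ ≤ weights x i
weights-nonneg x 0≤x front = toWitness {a? = 0ℚ ≤? 1ℚ} tt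
weights-nonneg x 0≤x back  = 0≤x

valid-bothExpire : ∀ x → 0ℚ ≤ x → ValidInstance 2 (weights x) bothExpire
valid-bothExpire x 0≤x = record
  { weights-nonneg  = weights-nonneg x 0≤x
  ; prefix-deletion = λ _ _ _ → ℕ.≤-refl
  ; active-≤2       = λ _ → s≤s z≤n
  }

valid-backSurvives : ∀ x → 0ℚ ≤ x → ValidInstance 2 (weights x) backSurvives
valid-backSurvives x 0≤x = record
  { weights-nonneg  = weights-nonneg x 0≤x
  ; prefix-deletion = prefix-deletion
  ; active-≤2       = active-≤2
  }
  where
  prefix-deletion : ∀ i j → i Fin.≤ j → backSurvives i ℕ.≤ backSurvives j
  prefix-deletion _ _ = s≤s
  active-≤2 : ∀ i → backSurvives i ℕ.≤ 2
  active-≤2 front = s≤s z≤n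
  active-≤2 back  = s≤s (s≤s z≤n)

firstPickGain : ℚ → Maybe (Fin 2) → ℚ
firstPickGain x nothing      = 0ℚ
firstPickGain x (just front) = 1ℚ
firstPickGain x (just back)  = x

onlyBack : Fin 2 → Bool
onlyBack front = false
onlyBack back  = true

weightOf-onlyBack : ∀ x → weightOf (weights x) onlyBack ≡ x
weightOf-onlyBack x = trans (+-identityˡ (x + 0ℚ)) (+-identityʳ x)

gain-bothExpire : ∀ x (s : Schedule 2) → gain (weights x) bothExpire s ≡ firstPickGain x (s 1)
gain-bothExpire x s =
  trans (gain-cong (weights x) bothExpire s (collected-suc bothExpire s 0)) (weightOf-firstPick (s 1))
  where
  weightOf-firstPick : ∀ m → weightOf (weights x) (collectStep bothExpire (λ _ → false) 1 m) ≡ firstPickGain x m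
  weightOf-firstPick nothing      = refl
  weightOf-firstPick (just front) = refl
  weightOf-firstPick (just back)  = weightOf-onlyBack x

gain-backSurvives : ∀ x (s : Schedule 2) → s 1 ≡ just back → gain (weights x) backSurvives s ≡ x
gain-backSurvives x s s₁≡back =
  trans (gain-cong (weights x) backSurvives s collected-after-step-2) (weightOf-onlyBack x)
  where
  pick-back : collectStep backSurvives (λ _ → false) 1 (just back) ≗ onlyBack
  pick-back front = refl
  pick-back back  = refl
  -- At step 2 the front item has been deleted and the back item is already collected.
  nothing-new : ∀ m i → collectStep backSurvives onlyBack 2 m i ≡ onlyBack i
  nothing-new nothing      _     = refl
  nothing-new (just front) front = refl
  nothing-new (just front) back  = refl
  nothing-new (just back)  front = refl
  nothing-new (just back)  back  = refl
  collected-after-step-1 : collected backSurvives s 1 ≗ onlyBack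
  collected-after-step-1 i = begin
    collected backSurvives s 1 i                                  ≡⟨ collected-suc backSurvives s 0 i ⟩
    collectStep backSurvives (λ _ → false) 1 (s 1) i              ≡⟨ cong (λ m → collectStep backSurvives (λ _ → false) 1 m i) s₁≡back ⟩
    collectStep backSurvives (λ _ → false) 1 (just back) i        ≡⟨ pick-back i ⟩
    onlyBack i                                                    ∎
    where open ≡-Reasoning
  collected-after-step-2 : collected backSurvives s 2 ≗ onlyBack
  collected-after-step-2 i = begin
    collected backSurvives s 2 i                                  ≡⟨ collected-suc backSurvives s 1 i ⟩
    collectStep backSurvives (collected backSurvives s 1) 2 (s 2) i ≡⟨ collectStep-cong backSurvives collected-after-step-1 2 (s 2) i ⟩
    collectStep backSurvives onlyBack 2 (s 2) i                   ≡⟨ nothing-new (s 2) i ⟩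
    onlyBack i                                                    ∎
    where open ≡-Reasoning

takeBack : Schedule 2
takeBack _ = just back

frontThenBack : Schedule 2
frontThenBack 1 = just front
frontThenBack _ = just back

gain-frontThenBack : ∀ x → gain (weights x) backSurvives frontThenBack ≡ 1ℚ + x
gain-frontThenBack x = cong (1ℚ +_) (+-identityʳ x)

sameFirstStep : ∀ A w → runOnline A 2 w backSurvives 1 ≡ runOnline A 2 w bothExpire 1
sameFirstStep A w = refl

adversary : ∀ A {R x} → 0ℚ < R → R < x → R * x < 1ℚ + x → NotCompetitive A R
adversary A {R} {x} 0<R R<x Rx<1+x = respond (runOnline A 2 (weights x) bothExpire 1) refl
  where
  open ≤-Reasoning
  0<x : 0ℚ < x
  0<x = <-trans 0<R R<x
  algGain-bothExpire : ∀ {m} → runOnline A 2 (weights x) bothExpire 1 ≡ m →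
                       algGain A 2 (weights x) bothExpire ≡ firstPickGain x m
  algGain-bothExpire first =
    trans (gain-bothExpire x (runOnline A 2 (weights x) bothExpire)) (cong (firstPickGain x) first)
  respond : ∀ m → runOnline A 2 (weights x) bothExpire 1 ≡ m → NotCompetitive A R
  respond (just back) first =
    2 , weights x , backSurvives , valid-backSurvives x (<⇒≤ 0<x) , frontThenBack , (begin-strict
      R * algGain A 2 (weights x) backSurvives
        ≡⟨ cong (R *_) (gain-backSurvives x (runOnline A 2 (weights x) backSurvives)
                          (trans (sameFirstStep A (weights x)) first)) ⟩
      R * x                                       <⟨ Rx<1+x ⟩
      1ℚ + x                                      ≡⟨ gain-frontThenBack x ⟨
      gain (weights x) backSurvives frontThenBack ∎)
  respond (just front) first =
    2 , weights x , bothExpire , valid-bothExpire x (<⇒≤ 0<x) , takeBack , (begin-strict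
      R * algGain A 2 (weights x) bothExpire ≡⟨ cong (R *_) (algGain-bothExpire first) ⟩
      R * 1ℚ                                 ≡⟨ *-identityʳ R ⟩
      R                                      <⟨ R<x ⟩
      x                                      ≡⟨ gain-bothExpire x takeBack ⟨
      gain (weights x) bothExpire takeBack   ∎)
  respond nothing first =
    2 , weights x , bothExpire , valid-bothExpire x (<⇒≤ 0<x) , takeBack , (begin-strict
      R * algGain A 2 (weights x) bothExpire ≡⟨ cong (R *_) (algGain-bothExpire first) ⟩
      R * 0ℚ                                 ≡⟨ *-zeroʳ R ⟩
      0ℚ                                     <⟨ 0<x ⟩
      x                                      ≡⟨ gain-bothExpire x takeBack ⟨
      gain (weights x) bothExpire takeBack   ∎)

belowGolden⇒square<succ : ∀ {R} → 0ℚ < R → BelowGolden R → R * R < R + 1ℚ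
belowGolden⇒square<succ {R} 0<R (inj₁ R≤1) = begin-strict
  R * R  ≤⟨ *-monoˡ-≤-nonNeg R {{nonNegative (<⇒≤ 0<R)}} R≤1 ⟩
  R * 1ℚ ≡⟨ *-identityʳ R ⟩
  R      ≡⟨ +-identityʳ R ⟨
  R + 0ℚ <⟨ +-monoʳ-< R (toWitness {a? = 0ℚ <? 1ℚ} tt) ⟩
  R + 1ℚ ∎
  where open ≤-Reasoning
belowGolden⇒square<succ 0<R (inj₂ R²<R+1) = R²<R+1

square<succ⇒<2 : ∀ {R} → 0ℚ < R → R * R < R + 1ℚ → R < 1ℚ + 1ℚ
square<succ⇒<2 {R} 0<R R²<R+1 with R ≤? 1ℚ
... | yes R≤1 = ≤-<-trans R≤1 (toWitness {a? = 1ℚ <? 1ℚ + 1ℚ} tt)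
... | no  R≰1 = *-cancelˡ-<-nonNeg R {{nonNegative (<⇒≤ 0<R)}} (begin-strict
  R * R           <⟨ R²<R+1 ⟩
  R + 1ℚ          <⟨ +-monoʳ-< R (≰⇒> R≰1) ⟩
  R + R           ≡⟨ solve 1 (λ r → r :+ r := r :* (con 1ℚ :+ con 1ℚ)) refl R ⟩
  R * (1ℚ + 1ℚ)   ∎)
  where open ≤-Reasoning

-- The witness is x = R + e with e = R + 1 - R², so that R x = R² + R e and 1 + x = R² + 2e.
golden-witness : ∀ {R} → 0ℚ < R → R * R < R + 1ℚ → R < 1ℚ + 1ℚ →
                 Σ ℚ λ x → R < x × R * x < 1ℚ + x
golden-witness {R} 0<R R²<R+1 R<2 = R + e , R<R+e , (begin-strict
  R * (R + e)       ≡⟨ *-distribˡ-+ R R e ⟩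
  R * R + R * e     <⟨ +-monoʳ-< (R * R) Re<e+e ⟩
  R * R + (e + e)   ≡⟨ solve 1 (λ r → r :* r :+ ((r :+ con 1ℚ :- r :* r) :+ (r :+ con 1ℚ :- r :* r))
                                  := con 1ℚ :+ (r :+ (r :+ con 1ℚ :- r :* r))) refl R ⟩
  1ℚ + (R + e)      ∎)
  where
  open ≤-Reasoning
  e : ℚ
  e = (R + 1ℚ) - R * R
  0<e : 0ℚ < e
  0<e = begin-strict
    0ℚ                   ≡⟨ +-inverseʳ (R * R) ⟨
    R * R - R * R        <⟨ +-monoˡ-< (- (R * R)) R²<R+1 ⟩
    e                    ∎
  R<R+e : R < R + e
  R<R+e = begin-strict
    R                    ≡⟨ +-identityʳ R ⟨
    R + 0ℚ               <⟨ +-monoʳ-< R 0<e ⟩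
    R + e                ∎
  Re<e+e : R * e < e + e
  Re<e+e = begin-strict
    R * e                ≡⟨ *-comm R e ⟩
    e * R                <⟨ *-monoʳ-<-pos e {{positive 0<e}} R<2 ⟩
    e * (1ℚ + 1ℚ)        ≡⟨ solve 1 (λ y → y :* (con 1ℚ :+ con 1ℚ) := y :+ y) refl e ⟩
    e + e                ∎

fact2 : (A : OnlineAlgorithm) (R : ℚ) → 0ℚ < R → BelowGolden R → NotCompetitive A R
fact2 A R 0<R below =
  let R²<R+1        = belowGolden⇒square<succ 0<R below
      x , R<x , Rx<1+x = golden-witness 0<R R²<R+1 (square<succ⇒<2 0<R R²<R+1)
  in  adversary A 0<R R<x Rx<1+x
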